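{- Let $G$ be a finite abelian group of order $n\ge 2$ with exponent $\kappa$, and let $\mathrm{Ord}(G,2)$ be the set of elements of $G$ of order at most $2$. If $\kappa\equiv 2\pmod 4$, then $$s(G,3)\le \frac{1}{4}\big(n-|\mathrm{Ord}(G,2)|\big).$$
   Context: $G$ is written additively. A subset $A=\{a_1,\dots,a_m\}$ (with $m\ge1$) of $G$ is called $t$-independent if whenever $\lambda_1a_1+\cdots+\lambda_ma_m=0$ for integers $\lambda_i$ with $\sum|\lambda_i|\le t$, we have all $\lambda_i=0$. $s(G,t)$ denotes the largest size of a $t$-independent subset of $G$ ($0$ if there is none). -}

module Defs where

open import Level using (Level)
open import Algebra.Bundles using (AbelianGroup)
open import Data.Nat using (ℕ; zero; suc; _+_; _≤_)
open import Data.Integer using (ℤ; +_; -[1+_]; ∣_∣)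
open import Data.Fin using (Fin)
import Data.Fin as Fin
open import Function.Bundles using (Bijection)
open import Relation.Binary.PropositionalEquality as ≡ using (_≡_)
open import Relation.Nullary using (Dec; yes; no)

module _ {c ℓ : Level} (G : AbelianGroup c ℓ) where
  open AbelianGroup G

  natMul : ℕ → Carrier → Carrier
  natMul zero    g = ε
  natMul (suc k) g = g ∙ natMul k g

  intMul : ℤ → Carrier → Carrier
  intMul (+ k)      g = natMul k g
  intMul -[1+ k ]   g = (natMul (suc k) g) ⁻¹

  sumG : (m : ℕ) → (Fin m → Carrier) → Carrier
  sumG zero    f = ε
  sumG (suc m) f = f Fin.zero ∙ sumG m (λ i → f (Fin.suc i))

  HasOrder : ℕ → Set _
  HasOrder n = Bijection (≡.setoid (Fin n)) setoid

  IsExponent : ℕ → Set _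
  IsExponent κ = (1 ≤ κ) × (∀ g → natMul κ g ≈ ε)
               × (∀ k → 1 ≤ k → (∀ g → natMul k g ≈ ε) → κ ≤ k)
    where open import Data.Product using (_×_)

  TIndependent : ℕ → (m : ℕ) → (Fin m → Carrier) → Set _
  TIndependent t m a =
    ∀ (lam : Fin m → ℤ) → sumℕ m (λ i → ∣ lam i ∣) ≤ t →
      sumG m (λ i → intMul (lam i) (a i)) ≈ ε → ∀ i → lam i ≡ + 0
    where
    sumℕ : (m : ℕ) → (Fin m → ℕ) → ℕ
    sumℕ zero    f = 0
    sumℕ (suc m) f = f Fin.zero + sumℕ m (λ i → f (Fin.suc i))

  Distinct : (m : ℕ) → (Fin m → Carrier) → Set _
  Distinct m a = ∀ i j → a i ≈ a j → i ≡ j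

  -- |Ord(G,2)|: number of g with g + g = 0 (order at most 2), counted
  -- through the enumeration of G; decidability of ≈ is derived from it.
  module _ {n : ℕ} (e : HasOrder n) where
    open Bijection e
    private
      back : Carrier → Fin n
      back y = Data.Product.proj₁ (strictlySurjective y)
        where import Data.Product
      back-spec : ∀ y → to (back y) ≈ y
      back-spec y = Data.Product.proj₂ (strictlySurjective y)
        where import Data.Product

    _≈?_ : ∀ x y → Dec (x ≈ y)
    x ≈? y with back x Fin.≟ back y
    ... | yes p = yes (trans (sym (back-spec x))
                        (trans (≡.subst (λ z → to (back x) ≈ to z) p refl) (back-spec y)))
    ... | no ¬p = no λ x≈y → ¬p (injective (trans (back-spec x) (trans x≈y (sym (back-spec y)))))

    countFin : (k : ℕ) → (Fin k → Carrier) → ℕ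
    countFin zero    f = 0
    countFin (suc k) f with (f Fin.zero ∙ f Fin.zero) ≈? ε
    ... | yes _ = suc (countFin k (λ i → f (Fin.suc i)))
    ... | no  _ = countFin k (λ i → f (Fin.suc i))

    ordTwoCount : ℕ
    ordTwoCount = countFin n to

{-# OPTIONS --safe #-}
-- Let S = {±aᵢ}. By 3-independence the 2m elements of S are distinct, none has
-- order at most 2, and no sum of two of them lies in S. Pick in each class of S
-- under s ↦ 2s a representative r(s) and put c(s) = s + r(s). As κ ≡ 2 (mod 4),
-- G has no element of order 4, so doubling is injective on 2G; since 2c(s) = 4s,
-- the c(s) are again distinct and of order greater than 2. So S ∪ c(S) consists
-- of 4m elements of order greater than 2, whence 4m + |Ord(G,2)| ≤ n.
module Submission where

open import Defs
open import Level using (Level; _⊔_)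
open import Algebra.Bundles using (AbelianGroup; CommutativeMonoid)
import Algebra.Properties.CommutativeMonoid.Sum as FinSum
open import Data.Nat using (ℕ; zero; suc; _+_; _*_; _∸_; _≤_; _%_; _/_; z≤n; s≤s)
import Data.Nat.Properties as ℕ
open import Data.Nat.Tactic.RingSolver using (solve-∀)
open import Data.Nat.DivMod using (m≡m%n+[m/n]*n)
open import Data.Integer as ℤ using (ℤ; +_; -[1+_]; ∣_∣; _⊖_)
import Data.Integer.Properties as ℤ
open import Data.Fin using (Fin; zero; suc; punchIn)
open import Data.Fin.Properties using (_≟_; any?; punchIn-injective; punchInᵢ≢i; +↔⊎)
open import Data.Sum using (_⊎_; inj₁; inj₂; swap; reduce; [_,_])
open import Data.Sum.Properties using (swap-involutive)
open import Data.Sum.Function.Propositional using (_⊎-↔_)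
open import Data.Product using (_,_; ∃-syntax)
open import Data.List using (List; []; _∷_; _++_; map; allFin; length; foldr)
open import Data.List.Membership.Propositional using (_∈_)
open import Data.List.Membership.Propositional.Properties using (∈-map⁺; ∈-++⁺ˡ; ∈-++⁺ʳ; ∈-allFin)
open import Data.List.Relation.Unary.Any using (here; there)
open import Data.Empty using (⊥-elim)
open import Function using (_∘_; _↔_; Injection; Inverse; Bijection)
open import Function.Construct.Composition using (_↔-∘_)
open import Function.Properties.Inverse using (↔⇒↣)
open import Relation.Binary using (Setoid; Decidable)
open import Relation.Binary.PropositionalEquality as ≡ using (_≡_; _≢_; cong)
open import Relation.Nullary using (¬_; Dec; yes; no; contradiction)

single : ∀ {m} → Fin m → ℤ → Fin m → ℤ
single zero    c zero    = c
single zero    c (suc _) = + 0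
single (suc _) c zero    = + 0
single (suc i) c (suc j) = single i c j

single-≡ : ∀ {m} {i j : Fin m} c → i ≡ j → single i c j ≡ c
single-≡ {i = zero}  c ≡.refl = ≡.refl
single-≡ {i = suc i} c ≡.refl = single-≡ {i = i} c ≡.refl

single-≢ : ∀ {m} {i j : Fin m} c → i ≢ j → single i c j ≡ + 0
single-≢ {i = zero}  {zero}  c i≢j = contradiction ≡.refl i≢j
single-≢ {i = zero}  {suc j} c i≢j = ≡.refl
single-≢ {i = suc i} {zero}  c i≢j = ≡.refl
single-≢ {i = suc i} {suc j} c i≢j = single-≢ c (i≢j ∘ cong suc)

module _ {a ℓ : Level} (M : CommutativeMonoid a ℓ) where
  open CommutativeMonoid M
  open FinSum M using (sum; sum-cong-≋; sum-replicate-zero)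

  sum-≈ε : ∀ {m} (f : Fin m → Carrier) → (∀ j → f j ≈ ε) → sum f ≈ ε
  sum-≈ε {m} _ f≈ε = trans (sum-cong-≋ f≈ε) (sum-replicate-zero m)

  sum-single : ∀ {m} (i : Fin m) c (h : Fin m → ℤ → Carrier) → (∀ j → h j (+ 0) ≈ ε) →
               sum (λ j → h j (single i c j)) ≈ h i c
  sum-single {suc m} zero    c h h0≈ε = trans (∙-congˡ (sum-≈ε _ (h0≈ε ∘ suc))) (identityʳ _)
  sum-single {suc m} (suc i) c h h0≈ε =
    trans (∙-congʳ (h0≈ε zero)) (trans (identityˡ _) (sum-single i c (h ∘ suc) (h0≈ε ∘ suc)))

module ℕ-Sum = FinSum ℕ.+-0-commutativeMonoid
module ℤ-Sum = FinSum ℤ.+-0-commutativeMonoid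

∑-mono-≤ : ∀ {m} {f g : Fin m → ℕ} → (∀ j → f j ≤ g j) → ℕ-Sum.sum f ≤ ℕ-Sum.sum g
∑-mono-≤ {zero}  f≤g = z≤n
∑-mono-≤ {suc m} f≤g = ℕ.+-mono-≤ (f≤g zero) (∑-mono-≤ (f≤g ∘ suc))

module Multiples {c ℓ : Level} (G : AbelianGroup c ℓ) where
  open AbelianGroup G
  open import Algebra.Properties.AbelianGroup G using (⁻¹-∙-comm; ε⁻¹≈ε)
  open import Algebra.Properties.CommutativeSemigroup commutativeSemigroup using (interchange)
  open import Algebra.Properties.Monoid.Mult monoid using (_×_; ×-homo-+)
  open import Relation.Binary.Reasoning.Setoid setoid

  natMul≡× : ∀ k x → natMul G k x ≡ k × x
  natMul≡× zero    x = ≡.refl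
  natMul≡× (suc k) x = cong (x ∙_) (natMul≡× k x)

  natMul-+ : ∀ j k x → natMul G (j + k) x ≈ natMul G j x ∙ natMul G k x
  natMul-+ j k x rewrite natMul≡× (j + k) x | natMul≡× j x | natMul≡× k x = ×-homo-+ x j k

  ∙-∙⁻¹-cancelˡ : ∀ x u v → (x ∙ u) ∙ (x ∙ v) ⁻¹ ≈ u ∙ v ⁻¹
  ∙-∙⁻¹-cancelˡ x u v = begin
    (x ∙ u) ∙ (x ∙ v) ⁻¹      ≈⟨ ∙-congˡ (⁻¹-∙-comm x v) ⟨
    (x ∙ u) ∙ (x ⁻¹ ∙ v ⁻¹)   ≈⟨ interchange x u (x ⁻¹) (v ⁻¹) ⟩
    (x ∙ x ⁻¹) ∙ (u ∙ v ⁻¹)   ≈⟨ ∙-congʳ (inverseʳ x) ⟩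
    ε ∙ (u ∙ v ⁻¹)            ≈⟨ identityˡ _ ⟩
    u ∙ v ⁻¹                  ∎

  intMul-⊖ : ∀ j k x → intMul G (j ⊖ k) x ≈ natMul G j x ∙ natMul G k x ⁻¹
  intMul-⊖ zero    zero    x = sym (trans (identityˡ _) ε⁻¹≈ε)
  intMul-⊖ zero    (suc k) x = sym (identityˡ _)
  intMul-⊖ (suc j) zero    x = sym (trans (∙-congˡ ε⁻¹≈ε) (identityʳ _))
  intMul-⊖ (suc j) (suc k) x = begin
    intMul G (suc j ⊖ suc k) x            ≡⟨ cong (λ u → intMul G u x) (ℤ.[1+m]⊖[1+n]≡m⊖n j k) ⟩
    intMul G (j ⊖ k) x                    ≈⟨ intMul-⊖ j k x ⟩
    natMul G j x ∙ natMul G k x ⁻¹        ≈⟨ ∙-∙⁻¹-cancelˡ x _ _ ⟨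
    natMul G (suc j) x ∙ natMul G (suc k) x ⁻¹ ∎

  intMul-+ : ∀ u v x → intMul G (u ℤ.+ v) x ≈ intMul G u x ∙ intMul G v x
  intMul-+ (+ j)    (+ k)    x = natMul-+ j k x
  intMul-+ (+ j)    -[1+ k ] x = intMul-⊖ j (suc k) x
  intMul-+ -[1+ j ] (+ k)    x = trans (intMul-⊖ k (suc j) x) (comm _ _)
  intMul-+ -[1+ j ] -[1+ k ] x = begin
    natMul G (suc (suc (j + k))) x ⁻¹
      ≡⟨ cong (λ i → natMul G i x ⁻¹) (cong suc (ℕ.+-suc j k)) ⟨
    natMul G (suc j + suc k) x ⁻¹                    ≈⟨ ⁻¹-cong (natMul-+ (suc j) (suc k) x) ⟩
    (natMul G (suc j) x ∙ natMul G (suc k) x) ⁻¹     ≈⟨ ⁻¹-∙-comm _ _ ⟨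
    natMul G (suc j) x ⁻¹ ∙ natMul G (suc k) x ⁻¹    ∎

  sumG≡sum : ∀ m (f : Fin m → Carrier) → sumG G m f ≡ FinSum.sum commutativeMonoid f
  sumG≡sum zero    f = ≡.refl
  sumG≡sum (suc m) f = cong (f zero ∙_) (sumG≡sum m (f ∘ suc))

module Doubling {c ℓ : Level} (G : AbelianGroup c ℓ) where
  open AbelianGroup G
  open import Algebra.Properties.AbelianGroup G using (⁻¹-∙-comm; x≈y⇒x∙y⁻¹≈ε; x∙y⁻¹≈ε⇒x≈y)
  open import Algebra.Properties.CommutativeSemigroup commutativeSemigroup using (interchange)
  open import Algebra.Properties.Monoid.Mult monoid using (_×_; ×-homo-+; ×-assocˡ; ×-congʳ)
  open import Algebra.Properties.Monoid.Sum monoid using (sum-replicate; sum-replicate-zero)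
  open import Relation.Binary.Reasoning.Setoid setoid
  open Multiples G using (natMul≡×)

  double : Carrier → Carrier
  double x = x ∙ x

  double-cong : ∀ {x y} → x ≈ y → double x ≈ double y
  double-cong x≈y = ∙-cong x≈y x≈y

  double-∙ : ∀ x y → double (x ∙ y) ≈ double x ∙ double y
  double-∙ x y = interchange x y x y

  double-∙⁻¹ : ∀ x y → double (x ∙ y ⁻¹) ≈ double x ∙ double y ⁻¹
  double-∙⁻¹ x y = trans (double-∙ x (y ⁻¹)) (∙-congˡ (⁻¹-∙-comm y y))

  NoOrderFour : Set (c ⊔ ℓ)
  NoOrderFour = ∀ x → double (double x) ≈ ε → double x ≈ ε

  exponent≡2[mod4]⇒NoOrderFour : ∀ {κ} → IsExponent G κ → κ % 4 ≡ 2 → NoOrderFour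
  exponent≡2[mod4]⇒NoOrderFour {κ} (_ , κ×x≈ε , _) κ%4≡2 x 4x≈ε = begin
    double x                 ≈⟨ ∙-congˡ (identityʳ x) ⟨
    2 × x                    ≈⟨ identityʳ _ ⟨
    2 × x ∙ ε                ≈⟨ ∙-congˡ (trans (sym (sum-replicate q)) (sum-replicate-zero q)) ⟨
    2 × x ∙ q × ε            ≈⟨ ∙-congˡ (×-congʳ q 4×x≈ε) ⟨
    2 × x ∙ q × (4 × x)      ≈⟨ ∙-congˡ (×-assocˡ x q 4) ⟩
    2 × x ∙ (q * 4) × x      ≈⟨ ×-homo-+ x 2 (q * 4) ⟨
    (2 + q * 4) × x          ≡⟨ cong (_× x) κ≡2+q*4 ⟨
    κ × x                    ≡⟨ natMul≡× κ x ⟨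
    natMul G κ x             ≈⟨ κ×x≈ε x ⟩
    ε                        ∎
    where
    q = κ / 4
    κ≡2+q*4 : κ ≡ 2 + q * 4
    κ≡2+q*4 = ≡.trans (m≡m%n+[m/n]*n κ 4) (cong (_+ q * 4) κ%4≡2)
    4×x≈ε : 4 × x ≈ ε
    4×x≈ε = trans (×-homo-+ x 2 2) (trans (double-cong (∙-congˡ (identityʳ x))) 4x≈ε)

  double-injectiveOnDoubles : NoOrderFour → ∀ {x y} →
                              double (double x) ≈ double (double y) → double x ≈ double y
  double-injectiveOnDoubles noOrderFour {x} {y} eq = x∙y⁻¹≈ε⇒x≈y _ _ (begin
    double x ∙ double y ⁻¹    ≈⟨ double-∙⁻¹ x y ⟨
    double (x ∙ y ⁻¹)         ≈⟨ noOrderFour (x ∙ y ⁻¹) (begin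
      double (double (x ∙ y ⁻¹))                  ≈⟨ double-cong (double-∙⁻¹ x y) ⟩
      double (double x ∙ double y ⁻¹)             ≈⟨ double-∙⁻¹ (double x) (double y) ⟩
      double (double x) ∙ double (double y) ⁻¹    ≈⟨ x≈y⇒x∙y⁻¹≈ε eq ⟩
      ε                                           ∎) ⟩
    ε                         ∎)

SignedIndex : ℕ → Set
SignedIndex m = Fin m ⊎ Fin m

index : ∀ {m} → SignedIndex m → Fin m
index = reduce

sign : ∀ {m} → SignedIndex m → ℤ
sign (inj₁ _) = + 1
sign (inj₂ _) = -[1+ 0 ]

coefficients : ∀ {m} → List (SignedIndex m) → Fin m → ℤ
coefficients []       j = + 0
coefficients (p ∷ ps) j = single (index p) (sign p) j ℤ.+ coefficients ps j

signSum : ∀ {m} → List (SignedIndex m) → ℤ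
signSum = foldr (λ p s → sign p ℤ.+ s) (+ 0)

∑∣coefficients∣≤length : ∀ {m} (ps : List (SignedIndex m)) →
                         ℕ-Sum.sum (λ j → ∣ coefficients ps j ∣) ≤ length ps
∑∣coefficients∣≤length {m} []   =
  ℕ.≤-reflexive (sum-≈ε ℕ.+-0-commutativeMonoid (λ j → ∣ coefficients {m} [] j ∣) (λ _ → ≡.refl))
∑∣coefficients∣≤length (p ∷ ps) = begin
  ℕ-Sum.sum (λ j → ∣ coefficients (p ∷ ps) j ∣)
    ≤⟨ ∑-mono-≤ (λ j → ℤ.∣i+j∣≤∣i∣+∣j∣ (single (index p) (sign p) j) (coefficients ps j)) ⟩
  ℕ-Sum.sum (λ j → ∣ single (index p) (sign p) j ∣ + ∣ coefficients ps j ∣)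
    ≡⟨ ℕ-Sum.∑-distrib-+ (λ j → ∣ single (index p) (sign p) j ∣) (λ j → ∣ coefficients ps j ∣) ⟩
  ℕ-Sum.sum (λ j → ∣ single (index p) (sign p) j ∣) + ℕ-Sum.sum (λ j → ∣ coefficients ps j ∣)
    ≡⟨ cong (_+ _) (sum-single ℕ.+-0-commutativeMonoid (index p) (sign p) (λ _ → ∣_∣) (λ _ → ≡.refl)) ⟩
  ∣ sign p ∣ + ℕ-Sum.sum (λ j → ∣ coefficients ps j ∣)
    ≤⟨ ℕ.+-mono-≤ (∣sign∣≤1 p) (∑∣coefficients∣≤length ps) ⟩
  length (p ∷ ps) ∎
  where
  open ℕ.≤-Reasoning
  ∣sign∣≤1 : ∀ p → ∣ sign p ∣ ≤ 1
  ∣sign∣≤1 (inj₁ _) = ℕ.≤-refl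
  ∣sign∣≤1 (inj₂ _) = ℕ.≤-refl

∑coefficients≡signSum : ∀ {m} (ps : List (SignedIndex m)) → ℤ-Sum.sum (coefficients ps) ≡ signSum ps
∑coefficients≡signSum {m} []   = sum-≈ε ℤ.+-0-commutativeMonoid (coefficients {m} []) (λ _ → ≡.refl)
∑coefficients≡signSum (p ∷ ps) = ≡.trans
  (ℤ-Sum.∑-distrib-+ (single (index p) (sign p)) (coefficients ps))
  (≡.cong₂ ℤ._+_ (sum-single ℤ.+-0-commutativeMonoid (index p) (sign p) (λ _ c → c) (λ _ → ≡.refl))
                 (∑coefficients≡signSum ps))

Vanishes : ∀ {m} → (Fin m → ℤ) → Set
Vanishes v = ∀ j → v j ≡ + 0

Vanishes⇒signSum≡0 : ∀ {m} (ps : List (SignedIndex m)) → Vanishes (coefficients ps) → signSum ps ≡ + 0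
Vanishes⇒signSum≡0 ps vanish =
  ≡.trans (≡.sym (∑coefficients≡signSum ps)) (sum-≈ε ℤ.+-0-commutativeMonoid (coefficients ps) vanish)

coefficients-pair : ∀ {m} (p q : SignedIndex m) → Vanishes (coefficients (p ∷ q ∷ [])) → q ≡ swap p
coefficients-pair p q vanish = decide (index q ≟ index p)
  where
  atIndexOfp : sign p ℤ.+ single (index q) (sign q) (index p) ≡ + 0
  atIndexOfp = ≡.trans
    (≡.cong₂ ℤ._+_ (≡.sym (single-≡ {i = index p} (sign p) ≡.refl)) (≡.sym (ℤ.+-identityʳ _)))
    (vanish (index p))
  sign+0≢0 : ∀ p → sign p ℤ.+ + 0 ≢ + 0
  sign+0≢0 (inj₁ _) ()
  sign+0≢0 (inj₂ _) ()
  opposite : ∀ p q → index q ≡ index p → sign p ℤ.+ sign q ≡ + 0 → q ≡ swap p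
  opposite (inj₁ _) (inj₂ _) q≡p _  = cong inj₂ q≡p
  opposite (inj₂ _) (inj₁ _) q≡p _  = cong inj₁ q≡p
  opposite (inj₁ _) (inj₁ _) _   ()
  opposite (inj₂ _) (inj₂ _) _   ()
  decide : Dec (index q ≡ index p) → q ≡ swap p
  decide (no  q≢p) =
    ⊥-elim (sign+0≢0 p (≡.trans (cong (ℤ._+_ (sign p)) (≡.sym (single-≢ (sign q) q≢p))) atIndexOfp))
  decide (yes q≡p) =
    opposite p q q≡p (≡.trans (cong (ℤ._+_ (sign p)) (≡.sym (single-≡ (sign q) q≡p))) atIndexOfp)

coefficients-triple : ∀ {m} (p q r : SignedIndex m) → ¬ Vanishes (coefficients (p ∷ q ∷ r ∷ []))
coefficients-triple p q r vanish = signSum₃≢0 p q r (Vanishes⇒signSum≡0 (p ∷ q ∷ r ∷ []) vanish)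
  where
  signSum₃≢0 : ∀ p q r → signSum (p ∷ q ∷ r ∷ []) ≢ + 0
  signSum₃≢0 (inj₁ _) (inj₁ _) (inj₁ _) ()
  signSum₃≢0 (inj₁ _) (inj₁ _) (inj₂ _) ()
  signSum₃≢0 (inj₁ _) (inj₂ _) (inj₁ _) ()
  signSum₃≢0 (inj₁ _) (inj₂ _) (inj₂ _) ()
  signSum₃≢0 (inj₂ _) (inj₁ _) (inj₁ _) ()
  signSum₃≢0 (inj₂ _) (inj₁ _) (inj₂ _) ()
  signSum₃≢0 (inj₂ _) (inj₂ _) (inj₁ _) ()
  signSum₃≢0 (inj₂ _) (inj₂ _) (inj₂ _) ()

-- TIndependent bounds ∑ ∣λᵢ∣ by a sum local to Defs, which cannot be named here;
-- weightIn reads it off the type.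
weightIn : ∀ {x y} {X : Set x} {W : X → ℕ} {t : ℕ} {Q : X → Set y} (T : Set (x ⊔ y)) →
           T ≡ ((v : X) → W v ≤ t → Q v) → X → ℕ
weightIn {W = W} _ _ = W

module Independence {c ℓ : Level} (G : AbelianGroup c ℓ) where
  open AbelianGroup G
  open Multiples G using (sumG≡sum)

  private
    -- The local sum ignores the parameters t and a, so the induction on m typechecks.
    weightIn-TIndependent : ∀ t m (a : Fin m → Carrier) (lam : Fin m → ℤ) →
                            weightIn (TIndependent G t m a) ≡.refl lam ≡ ℕ-Sum.sum (λ i → ∣ lam i ∣)
    weightIn-TIndependent t zero    a lam = ≡.refl
    weightIn-TIndependent t (suc m) a lam =
      cong (_+_ ∣ lam zero ∣) (weightIn-TIndependent t m (a ∘ suc) (lam ∘ suc))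

  TIndependent-elim : ∀ {t m} {a : Fin m → Carrier} → TIndependent G t m a → ∀ lam →
    ℕ-Sum.sum (λ i → ∣ lam i ∣) ≤ t →
    FinSum.sum commutativeMonoid (λ i → intMul G (lam i) (a i)) ≈ ε → Vanishes lam
  TIndependent-elim {t} {m} {a} indep lam weight≤t combination≈ε =
    indep lam (≡.subst (_≤ t) (≡.sym (weightIn-TIndependent t m a lam)) weight≤t)
          (trans (reflexive (sumG≡sum m _)) combination≈ε)

module Combinations {c ℓ : Level} (G : AbelianGroup c ℓ) {m : ℕ} (a : Fin m → AbelianGroup.Carrier G) where
  open AbelianGroup G
  open import Algebra.Properties.AbelianGroup G using (⁻¹-involutive; x≈y⇒x∙y⁻¹≈ε)
  open import Relation.Binary.Reasoning.Setoid setoid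
  open Multiples G using (intMul-+)
  open Doubling G using (double)
  open Independence G using (TIndependent-elim)
  open FinSum commutativeMonoid using (sum; sum-cong-≋; ∑-distrib-+)

  signed : SignedIndex m → Carrier
  signed (inj₁ i) = a i
  signed (inj₂ i) = a i ⁻¹

  signed-swap : ∀ p → signed (swap p) ≈ signed p ⁻¹
  signed-swap (inj₁ _) = refl
  signed-swap (inj₂ _) = sym (⁻¹-involutive _)

  intMul-sign : ∀ p → intMul G (sign p) (a (index p)) ≈ signed p
  intMul-sign (inj₁ _) = identityʳ _
  intMul-sign (inj₂ _) = ⁻¹-cong (identityʳ _)

  signedSum : List (SignedIndex m) → Carrier
  signedSum = foldr (λ p x → signed p ∙ x) ε

  ∑-coefficients : ∀ ps → sum (λ j → intMul G (coefficients ps j) (a j)) ≈ signedSum ps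
  ∑-coefficients []       = sum-≈ε commutativeMonoid (λ j → intMul G (coefficients [] j) (a j)) (λ _ → refl)
  ∑-coefficients (p ∷ ps) = begin
    sum (λ j → intMul G (coefficients (p ∷ ps) j) (a j))
      ≈⟨ sum-cong-≋ (λ j → intMul-+ (single (index p) (sign p) j) (coefficients ps j) (a j)) ⟩
    sum (λ j → intMul G (single (index p) (sign p) j) (a j) ∙ intMul G (coefficients ps j) (a j))
      ≈⟨ ∑-distrib-+ (λ j → intMul G (single (index p) (sign p) j) (a j))
                     (λ j → intMul G (coefficients ps j) (a j)) ⟩
    sum (λ j → intMul G (single (index p) (sign p) j) (a j)) ∙ sum (λ j → intMul G (coefficients ps j) (a j))
      ≈⟨ ∙-cong (sum-single commutativeMonoid (index p) (sign p) (λ j u → intMul G u (a j)) (λ _ → refl))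
                (∑-coefficients ps) ⟩
    intMul G (sign p) (a (index p)) ∙ signedSum ps
      ≈⟨ ∙-congʳ (intMul-sign p) ⟩
    signedSum (p ∷ ps) ∎

  module _ (indep : TIndependent G 3 m a) where

    vanishes : ∀ ps → length ps ≤ 3 → signedSum ps ≈ ε → Vanishes (coefficients ps)
    vanishes ps length≤3 signedSum≈ε =
      TIndependent-elim indep (coefficients ps) (ℕ.≤-trans (∑∣coefficients∣≤length ps) length≤3)
                        (trans (∑-coefficients ps) signedSum≈ε)

    signed-injective : ∀ {p q} → signed p ≈ signed q → p ≡ q
    signed-injective {p} {q} p≈q =
      ≡.trans (coefficients-pair (swap q) p (vanishes (swap q ∷ p ∷ []) (s≤s (s≤s z≤n)) q⁻¹∙p≈ε))
              (swap-involutive q)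
      where
      q⁻¹∙p≈ε : signed (swap q) ∙ (signed p ∙ ε) ≈ ε
      q⁻¹∙p≈ε = begin
        signed (swap q) ∙ (signed p ∙ ε)   ≈⟨ ∙-cong (signed-swap q) (identityʳ _) ⟩
        signed q ⁻¹ ∙ signed p             ≈⟨ comm _ _ ⟩
        signed p ∙ signed q ⁻¹             ≈⟨ x≈y⇒x∙y⁻¹≈ε p≈q ⟩
        ε                                  ∎

    double-signed≉ε : ∀ p → ¬ double (signed p) ≈ ε
    double-signed≉ε p p+p≈ε =
      p≢swap-p p (coefficients-pair p p
        (vanishes (p ∷ p ∷ []) (s≤s (s≤s z≤n)) (trans (∙-congˡ (identityʳ _)) p+p≈ε)))
      where
      p≢swap-p : ∀ p → p ≢ swap p
      p≢swap-p (inj₁ _) ()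
      p≢swap-p (inj₂ _) ()

    signed∙signed≉signed : ∀ p q r → ¬ signed p ∙ signed q ≈ signed r
    signed∙signed≉signed p q r p+q≈r =
      coefficients-triple p q (swap r) (vanishes (p ∷ q ∷ swap r ∷ []) (s≤s (s≤s (s≤s z≤n))) p+q-r≈ε)
      where
      p+q-r≈ε : signed p ∙ (signed q ∙ (signed (swap r) ∙ ε)) ≈ ε
      p+q-r≈ε = begin
        signed p ∙ (signed q ∙ (signed (swap r) ∙ ε))
          ≈⟨ ∙-congˡ (∙-congˡ (trans (identityʳ _) (signed-swap r))) ⟩
        signed p ∙ (signed q ∙ signed r ⁻¹)             ≈⟨ assoc _ _ _ ⟨
        (signed p ∙ signed q) ∙ signed r ⁻¹             ≈⟨ x≈y⇒x∙y⁻¹≈ε p+q≈r ⟩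
        ε                                               ∎

module Counting {c ℓ : Level} (G : AbelianGroup c ℓ) {n : ℕ} (e : HasOrder G n) where
  open AbelianGroup G
  open Doubling G using (double; double-cong)

  private
    hits-in-tail : ∀ {k j} {f : Fin (suc k) → Carrier} {g : Fin j → Carrier} →
                   (∀ i → ∃[ l ] f l ≈ g i) → (∀ i → ¬ f zero ≈ g i) → ∀ i → ∃[ l ] f (suc l) ≈ g i
    hits-in-tail hit miss i with hit i
    ... | zero  , f₀≈gᵢ = ⊥-elim (miss i f₀≈gᵢ)
    ... | suc l , fₗ≈gᵢ = l , fₗ≈gᵢ

  -- The case split mirrors the definition of countFin, so that it unfolds.
  j+countFin≤k : ∀ k (f : Fin k → Carrier) {j} (g : Fin j → Carrier) →
                 (∀ {i i'} → g i ≈ g i' → i ≡ i') → (∀ i → ¬ double (g i) ≈ ε) →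
                 (∀ i → ∃[ l ] f l ≈ g i) → j + countFin G e k f ≤ k
  j+countFin≤k zero    f {zero}  g _   _   _   = z≤n
  j+countFin≤k zero    f {suc j} g _   _   hit with hit zero
  ... | () , _
  j+countFin≤k (suc k) f {j}     g inj odd hit with _≈?_ G e (f zero ∙ f zero) ε
  ... | yes f₀+f₀≈ε = ℕ.≤-trans (ℕ.≤-reflexive (ℕ.+-suc j _))
      (s≤s (j+countFin≤k k (f ∘ suc) g inj odd
              (hits-in-tail hit (λ i f₀≈gᵢ → odd i (trans (double-cong (sym f₀≈gᵢ)) f₀+f₀≈ε)))))
  ... | no _ with any? (λ i → _≈?_ G e (g i) (f zero))
  ...   | no f₀∉g = ℕ.m≤n⇒m≤1+n
      (j+countFin≤k k (f ∘ suc) g inj odd (hits-in-tail hit (λ i f₀≈gᵢ → f₀∉g (i , sym f₀≈gᵢ))))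
  j+countFin≤k (suc k) f {suc j} g inj odd hit | no _ | yes (i₀ , gᵢ₀≈f₀) =
    s≤s (j+countFin≤k k (f ∘ suc) (g ∘ punchIn i₀) (punchIn-injective i₀ _ _ ∘ inj) (odd ∘ punchIn i₀)
           (hits-in-tail (hit ∘ punchIn i₀)
              (λ i f₀≈g[i'] → punchInᵢ≢i i₀ i (inj (trans (sym f₀≈g[i']) (sym gᵢ₀≈f₀))))))

module Representatives {a c ℓ : Level} {A : Set a} (S : Setoid c ℓ) (_≟ₛ_ : Decidable (Setoid._≈_ S))
                       (f : A → Setoid.Carrier S) where
  open Setoid S

  representative : List A → A → A
  representative []       x = x
  representative (y ∷ ys) x with f y ≟ₛ f x
  ... | yes _ = y
  ... | no  _ = representative ys x

  representative-≈ : ∀ ys x → f (representative ys x) ≈ f x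
  representative-≈ []       x = refl
  representative-≈ (y ∷ ys) x with f y ≟ₛ f x
  ... | yes fy≈fx = fy≈fx
  ... | no  _     = representative-≈ ys x

  representative-cong : ∀ {ys x x'} → x ∈ ys → f x ≈ f x' → representative ys x ≡ representative ys x'
  representative-cong {y ∷ ys} {x} {x'} x∈ fx≈fx' with f y ≟ₛ f x | f y ≟ₛ f x'
  ... | yes _     | yes _      = ≡.refl
  ... | yes fy≈fx | no  fy≉fx' = contradiction (trans fy≈fx fx≈fx') fy≉fx'
  ... | no  fy≉fx | yes fy≈fx' = contradiction (trans fy≈fx' (sym fx≈fx')) fy≉fx
  ... | no  fy≉fx | no  _      with x∈
  ...   | here ≡.refl = contradiction refl fy≉fx
  ...   | there x∈ys  = representative-cong x∈ys fx≈fx'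

module Construction {c ℓ : Level} (G : AbelianGroup c ℓ) {n : ℕ} (e : HasOrder G n)
                    (noOrderFour : Doubling.NoOrderFour G)
                    {m : ℕ} (a : Fin m → AbelianGroup.Carrier G) (indep : TIndependent G 3 m a) where
  open AbelianGroup G
  open import Algebra.Properties.AbelianGroup G using (∙-cancelʳ)
  open Doubling G
  open Combinations G a
  open Counting G e

  signedIndices : List (SignedIndex m)
  signedIndices = map inj₁ (allFin m) ++ map inj₂ (allFin m)

  ∈-signedIndices : ∀ p → p ∈ signedIndices
  ∈-signedIndices (inj₁ i) = ∈-++⁺ˡ (∈-map⁺ inj₁ (∈-allFin i))
  ∈-signedIndices (inj₂ i) = ∈-++⁺ʳ (map inj₁ (allFin m)) (∈-map⁺ inj₂ (∈-allFin i))

  open Representatives setoid (_≈?_ G e) (double ∘ signed)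

  -- As 2 · companion p = 4 · signed p, companion p determines the class of p under
  -- doubling, hence the summand added to signed p, hence p.
  companion : SignedIndex m → Carrier
  companion p = signed p ∙ signed (representative signedIndices p)

  double-companion : ∀ p → double (companion p) ≈ double (double (signed p))
  double-companion p = trans (double-∙ _ _) (∙-congˡ (representative-≈ signedIndices p))

  companion-injective : ∀ {p q} → companion p ≈ companion q → p ≡ q
  companion-injective {p} {q} eq =
    signed-injective indep
      (∙-cancelʳ _ _ _ (trans eq (∙-congˡ (reflexive (cong signed (≡.sym same-representative))))))
    where
    double-p≈double-q : double (signed p) ≈ double (signed q)
    double-p≈double-q = double-injectiveOnDoubles noOrderFour
      (trans (sym (double-companion p)) (trans (double-cong eq) (double-companion q)))
    same-representative : representative signedIndices p ≡ representative signedIndices q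
    same-representative = representative-cong (∈-signedIndices p) double-p≈double-q

  double-companion≉ε : ∀ p → ¬ double (companion p) ≈ ε
  double-companion≉ε p 2c≈ε =
    double-signed≉ε indep p (noOrderFour (signed p) (trans (sym (double-companion p)) 2c≈ε))

  embedding : SignedIndex m ⊎ SignedIndex m → Carrier
  embedding = [ signed , companion ]

  embedding-injective : ∀ {u v} → embedding u ≈ embedding v → u ≡ v
  embedding-injective {inj₁ p} {inj₁ q} eq = cong inj₁ (signed-injective indep eq)
  embedding-injective {inj₂ p} {inj₂ q} eq = cong inj₂ (companion-injective eq)
  embedding-injective {inj₁ p} {inj₂ q} eq =
    ⊥-elim (signed∙signed≉signed indep q (representative signedIndices q) p (sym eq))
  embedding-injective {inj₂ p} {inj₁ q} eq =
    ⊥-elim (signed∙signed≉signed indep p (representative signedIndices p) q eq)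

  double-embedding≉ε : ∀ u → ¬ double (embedding u) ≈ ε
  double-embedding≉ε (inj₁ p) = double-signed≉ε indep p
  double-embedding≉ε (inj₂ p) = double-companion≉ε p

  enumeration : Fin ((m + m) + (m + m)) ↔ (SignedIndex m ⊎ SignedIndex m)
  enumeration = (+↔⊎ ⊎-↔ +↔⊎) ↔-∘ +↔⊎

  4m+ordTwoCount≤n : (m + m) + (m + m) + ordTwoCount G e ≤ n
  4m+ordTwoCount≤n = j+countFin≤k n to (embedding ∘ Inverse.to enumeration)
    (Injection.injective (↔⇒↣ enumeration) ∘ embedding-injective)
    (double-embedding≉ε ∘ Inverse.to enumeration)
    (strictlySurjective ∘ embedding ∘ Inverse.to enumeration)
    where open Bijection e using (to; strictlySurjective)

4*m≡[m+m]+[m+m] : ∀ m → 4 * m ≡ (m + m) + (m + m)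
4*m≡[m+m]+[m+m] = solve-∀

proposition10 : {c ℓ : Level} (G : AbelianGroup c ℓ) (n : ℕ) (e : HasOrder G n) →
    2 ≤ n → (κ : ℕ) → IsExponent G κ → κ % 4 ≡ 2 →
    (m : ℕ) (a : Fin m → AbelianGroup.Carrier G) → Distinct G m a →
    TIndependent G 3 m a → 4 * m ≤ n ∸ ordTwoCount G e
proposition10 G n e _ _ exponent κ%4≡2 m a _ indep =
  ℕ.m+n≤o⇒m≤o∸n (4 * m)
    (≡.subst (λ k → k + ordTwoCount G e ≤ n) (≡.sym (4*m≡[m+m]+[m+m] m))
      (Construction.4m+ordTwoCount≤n G e (Doubling.exponent≡2[mod4]⇒NoOrderFour G exponent κ%4≡2) a indep))
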